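{- The smallest variety of groupoids (algebras with one binary operation) containing all rectangular groupoids is the variety of all groupoids. Equivalently, every groupoid is a homomorphic image of some rectangular groupoid, so rectangular groupoids satisfy no nontrivial identities.
   Context: A groupoid $(A,*)$ is a rectangular groupoid if for all $a,b,c,d,x\in A$: $a*b=c*d=x$ implies $a*d=c*b=x$. -}

module Defs where

open import Data.Nat using (ℕ)
open import Data.Product using (Σ; ∃; _×_)
open import Relation.Binary.PropositionalEquality using (_≡_)

record Groupoid : Set₁ where
  field
    Carrier : Set
    _∙_     : Carrier → Carrier → Carrier

IsRectangular : Groupoid → Set
IsRectangular G = ∀ (a b c d x : Carrier) →
    a ∙ b ≡ x → c ∙ d ≡ x → (a ∙ d ≡ x) × (c ∙ b ≡ x)
  where open Groupoid G

IsSurjHom : (H G : Groupoid) → (Groupoid.Carrier H → Groupoid.Carrier G) → Set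
IsSurjHom H G f =
  (∀ x y → f (x ∙ᴴ y) ≡ f x ∙ᴳ f y) × (∀ a → ∃ λ b → f b ≡ a)
  where
    open Groupoid H renaming (_∙_ to _∙ᴴ_)
    open Groupoid G renaming (_∙_ to _∙ᴳ_)

HomImage : (G H : Groupoid) → Set
HomImage G H = Σ (Groupoid.Carrier H → Groupoid.Carrier G) (IsSurjHom H G)

data Term : Set where
  var  : ℕ → Term
  _·_  : Term → Term → Term

eval : (G : Groupoid) → (ℕ → Groupoid.Carrier G) → Term → Groupoid.Carrier G
eval G ρ (var n) = ρ n
eval G ρ (s · t) = Groupoid._∙_ G (eval G ρ s) (eval G ρ t)

Satisfies : Groupoid → Term → Term → Set
Satisfies G s t = ∀ (ρ : ℕ → Groupoid.Carrier G) → eval G ρ s ≡ eval G ρ t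

-- The key observation is that a groupoid whose operation is injective as a
-- map of pairs (a ∙ b ≡ c ∙ d forces a ≡ c and b ≡ d) is rectangular: if
-- a ∙ b and c ∙ d are the same element then a ≡ c and b ≡ d, so a ∙ d and
-- c ∙ b are that element as well.  Absolutely free groupoids have exactly
-- this property.  Hence
--   * every groupoid G is the image of the free groupoid of binary trees
--     with leaves in G, under the evaluation map, which is a rectangular
--     groupoid;
--   * the term groupoid (terms with formal product) is rectangular, and
--     evaluating a term there at the variables returns the term itself, so
--     an identity s ≈ t holding in it forces s ≡ t.
module Submission where

open import Defs
open import Data.Product using (Σ; _×_; _,_)
open import Relation.Binary.PropositionalEquality
  using (_≡_; refl; sym; trans; cong₂; module ≡-Reasoning)

IsPairingInjective : Groupoid → Set
IsPairingInjective G = ∀ (a b c d : Carrier) → a ∙ b ≡ c ∙ d → (a ≡ c) × (b ≡ d)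
  where open Groupoid G

pairingInjective⇒rectangular : (G : Groupoid) → IsPairingInjective G → IsRectangular G
pairingInjective⇒rectangular G inj a b c d x ab≡x cd≡x
  with inj a b c d (trans ab≡x (sym cd≡x))
... | refl , refl = ab≡x , cd≡x

data Tree (A : Set) : Set where
  leaf : A → Tree A
  node : Tree A → Tree A → Tree A

FreeGroupoid : Set → Groupoid
FreeGroupoid A = record { Carrier = Tree A ; _∙_ = node }

freeGroupoid-rectangular : (A : Set) → IsRectangular (FreeGroupoid A)
freeGroupoid-rectangular A = pairingInjective⇒rectangular (FreeGroupoid A) node-injective
  where
    node-injective : IsPairingInjective (FreeGroupoid A)
    node-injective a b .a .b refl = refl , refl

evalTree : (G : Groupoid) → Tree (Groupoid.Carrier G) → Groupoid.Carrier G
evalTree G (leaf x)   = x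
evalTree G (node s t) = Groupoid._∙_ G (evalTree G s) (evalTree G t)

evalTree-surjHom : (G : Groupoid) → IsSurjHom (FreeGroupoid (Groupoid.Carrier G)) G (evalTree G)
evalTree-surjHom G = (λ _ _ → refl) , λ x → leaf x , refl

homImage-of-rectangular : (G : Groupoid) → Σ Groupoid (λ H → IsRectangular H × HomImage G H)
homImage-of-rectangular G =
  FreeGroupoid Carrier , freeGroupoid-rectangular Carrier , evalTree G , evalTree-surjHom G
  where open Groupoid G

TermGroupoid : Groupoid
TermGroupoid = record { Carrier = Term ; _∙_ = _·_ }

termGroupoid-rectangular : IsRectangular TermGroupoid
termGroupoid-rectangular = pairingInjective⇒rectangular TermGroupoid ·-injective
  where
    ·-injective : IsPairingInjective TermGroupoid
    ·-injective a b .a .b refl = refl , refl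

eval-var : (u : Term) → eval TermGroupoid var u ≡ u
eval-var (var n) = refl
eval-var (u · v) = cong₂ _·_ (eval-var u) (eval-var v)

identity-trivial : (s t : Term) → ((H : Groupoid) → IsRectangular H → Satisfies H s t) → s ≡ t
identity-trivial s t holds = begin
    s                        ≡⟨ sym (eval-var s) ⟩
    eval TermGroupoid var s  ≡⟨ holds TermGroupoid termGroupoid-rectangular var ⟩
    eval TermGroupoid var t  ≡⟨ eval-var t ⟩
    t                        ∎
  where open ≡-Reasoning

mainTheorem8 : ((G : Groupoid) → Σ Groupoid (λ H → IsRectangular H × HomImage G H))
    × ((s t : Term) → ((H : Groupoid) → IsRectangular H → Satisfies H s t) → s ≡ t)
mainTheorem8 = homImage-of-rectangular , identity-trivial
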